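{- Every graph $G$ with layered treewidth $k$ satisfies $\mathrm{scol}_r(G)\leq k(2r+1)$ for every integer $r\geq 1$.
   Context: All graphs are finite and simple. A layering of $G$ is a partition $(V_1,\dots,V_\ell)$ of $V(G)$ such that for every edge $vw$ with $v\in V_i$, $w\in V_j$ we have $|i-j|\le 1$. A tree decomposition of $G$ is a tree $T$ with bags $T_x\subseteq V(G)$ ($x\in V(T)$) such that every edge of $G$ lies in some bag and, for each vertex $v$, the nodes whose bags contain $v$ induce a non-empty subtree of $T$. The layered width of a tree decomposition is the minimum $k$ such that for some layering of $G$ each bag contains at most $k$ vertices of each layer; the layered treewidth of $G$ is the minimum layered width over all tree decompositions of $G$. For a linear ordering $\preceq$ of $V(G)$, a vertex $v$ and $r\ge1$, $S_r(G,\preceq,v)$ is the set of vertices $x$ for which there is a path $v=w_0,w_1,\dots,w_{r'}=x$ with $0\le r'\le r$, $x\preceq v$ and $v\prec w_i$ for all $1\le i\le r'-1$; $\mathrm{scol}_r(G)$ is the minimum $k$ such that some linear ordering satisfies $|S_r(G,\preceq,v)|\le k$ for every vertex $v$. -}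

module Defs where

open import Data.Nat using (ℕ; zero; suc; _≤_; _<_)
open import Data.Fin using (Fin)
open import Data.Bool using (Bool; true; false)
open import Data.Maybe using (Maybe; just)
open import Data.List using (List; []; _∷_; length; head; last)
open import Data.List.Relation.Unary.All using (All)
open import Data.List.Relation.Unary.Linked using (Linked)
open import Data.List.Relation.Unary.Unique.Propositional using (Unique)
open import Data.List.Membership.Propositional using (_∈_)
open import Data.Product using (Σ; ∃; _×_; _,_)
open import Relation.Binary.PropositionalEquality using (_≡_)
open import Relation.Nullary using (¬_)
open import Function.Definitions using (Injective)

record Graph : Set where
  field
    n      : ℕ
    adj    : Fin n → Fin n → Bool
    sym    : ∀ x y → adj x y ≡ adj y x
    irrefl : ∀ x → adj x x ≡ false

open Graph public

Vtx : Graph → Set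
Vtx G = Fin (n G)

Edge : (G : Graph) → Vtx G → Vtx G → Set
Edge G x y = adj G x y ≡ true

PathFromTo : (G : Graph) → Vtx G → Vtx G → List (Vtx G) → Set
PathFromTo G a b ws =
  Linked (Edge G) ws × Unique ws × head ws ≡ just a × last ws ≡ just b

dropLast : {A : Set} → List A → List A
dropLast []           = []
dropLast (x ∷ [])     = []
dropLast (x ∷ y ∷ ys) = x ∷ dropLast (y ∷ ys)

interior : {A : Set} → List A → List A
interior []       = []
interior (x ∷ xs) = dropLast xs

HasCycle : Graph → Set
HasCycle G = Σ (Vtx G) λ a → Σ (Vtx G) λ b → Σ (List (Vtx G)) λ ws →
  PathFromTo G a b ws × 3 ≤ length ws × Edge G b a

record IsTree (T : Graph) : Set where
  field
    nonempty  : Vtx T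
    connected : ∀ a b → ∃ λ ws → PathFromTo T a b ws
    acyclic   : ¬ HasCycle T

record TreeDecomposition (G : Graph) : Set where
  field
    T       : Graph
    isTree  : IsTree T
    bag     : Vtx T → Vtx G → Bool
    edgeCov : ∀ v w → Edge G v w →
              ∃ λ t → bag t v ≡ true × bag t w ≡ true
    -- the nodes whose bags contain v induce a non-empty subtree of T
    vtxNonempty  : ∀ v → ∃ λ t → bag t v ≡ true
    vtxConnected : ∀ v s t → bag s v ≡ true → bag t v ≡ true →
                   ∃ λ ws → PathFromTo T s t ws × All (λ u → bag u v ≡ true) ws

open TreeDecomposition public

AtMost : {A : Set} → ℕ → (A → Set) → Set
AtMost {A} k P = ∃ λ (xs : List A) → length xs ≤ k × (∀ x → P x → x ∈ xs)

-- A layering, given by the layer index of each vertex (layer V_i = layer⁻¹(i)).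
IsLayering : (G : Graph) → (Vtx G → ℕ) → Set
IsLayering G layer = ∀ v w → Edge G v w →
  layer v ≤ suc (layer w) × layer w ≤ suc (layer v)

LayeredWidthAtMost : {G : Graph} → TreeDecomposition G → ℕ → Set
LayeredWidthAtMost {G} D k = Σ (Vtx G → ℕ) λ layer → IsLayering G layer ×
  (∀ t i → AtMost k (λ v → bag D t v ≡ true × layer v ≡ i))

LtwAtMost : Graph → ℕ → Set
LtwAtMost G k = Σ (TreeDecomposition G) λ D → LayeredWidthAtMost D k

IsLayeredTreewidth : Graph → ℕ → Set
IsLayeredTreewidth G k = LtwAtMost G k × (∀ k' → LtwAtMost G k' → k ≤ k')

-- A linear ordering of V(G), given by an injective rank function:
-- x ≺ y iff rank x < rank y.
record LinearOrdering (G : Graph) : Set where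
  field
    rank  : Vtx G → ℕ
    inj   : Injective _≡_ _≡_ rank

open LinearOrdering public

InS : (G : Graph) → LinearOrdering G → ℕ → Vtx G → Vtx G → Set
InS G ord r v x = Σ (List (Vtx G)) λ ws →
  PathFromTo G v x ws × length ws ≤ suc r ×
  rank ord x ≤ rank ord v ×
  All (λ w → rank ord v < rank ord w) (interior ws)

ScolAtMost : Graph → ℕ → ℕ → Set
ScolAtMost G r K = Σ (LinearOrdering G) λ ord →
  ∀ v → AtMost K (InS G ord r v)

module Submission where

-- Root the decomposition tree and let top(v) be the node nearest the root whose
-- bag contains v; order the vertices by the depth of top(v).  If x is strongly
-- r-reachable from v, every interior vertex w of the witnessing path has top(w)
-- at least as deep as top(v), so, walking along the path, the subtree property
-- keeps all bags of the vertices met inside the subtree below top(v).  The last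
-- edge puts x into a bag below top(v), while top(x) is no deeper than top(v);
-- connectivity of the bags of x then forces x into the bag of top(v).  Since x is
-- within r layers of v, the bag of top(v) has at most k(2r+1) candidates.

open import Defs
open import Data.Nat using (ℕ; zero; suc; _≤_; _<_; _*_; _+_; _∸_; z≤n; s≤s; s≤s⁻¹)
open import Data.Nat.Properties
open import Data.Nat.Tactic.RingSolver using (solve-∀)
open import Data.Fin using (toℕ) renaming (_≟_ to _≟ᶠ_)
open import Data.Fin.Properties using (toℕ-injective; toℕ<n)
open import Data.Bool using (true) renaming (_≟_ to _≟ᵇ_)
open import Data.Maybe using (just)
open import Data.Maybe.Properties using (just-injective)
open import Data.List using (List; []; _∷_; length; head; last; _++_; allFin; filter)
open import Data.List.Properties using (length-++)
open import Data.List.Extrema.Nat using (argmin; argmin-all; f[argmin]≤f[xs])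
open import Data.List.Relation.Unary.All as All using (All; []; _∷_)
open import Data.List.Relation.Unary.All.Properties using (¬Any⇒All¬; ++⁻ʳ; all-filter)
open import Data.List.Relation.Unary.AllPairs using ([]; _∷_)
open import Data.List.Relation.Unary.Any using (here; there)
open import Data.List.Relation.Unary.Linked as Linked using (Linked; []; [-]; _∷_)
open import Data.List.Membership.Propositional using (_∈_; _∉_)
open import Data.List.Membership.Propositional.Properties using (∈-allFin; ∈-filter⁺; ∈-++⁺ˡ; ∈-++⁺ʳ)
open import Data.Product using (∃; ∃₂; _×_; _,_; proj₁; proj₂; uncurry)
open import Data.Sum using (_⊎_; inj₁; inj₂)
open import Data.Empty using (⊥-elim)
open import Function using (_∘_)
open import Function.Definitions using (Injective)
open import Relation.Nullary using (¬_; Dec; yes; no)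
open import Relation.Nullary.Decidable using (decidable-stable)
open import Relation.Binary.PropositionalEquality
  using (_≡_; _≢_; refl; cong; subst; trans; module ≡-Reasoning) renaming (sym to ≡-sym)
open import Relation.Binary.Construct.Closure.ReflexiveTransitive using (Star; ε; _◅_; _◅◅_; reverse)

∈-last : ∀ {A : Set} {b : A} xs → last xs ≡ just b → b ∈ xs
∈-last (x ∷ [])     refl = here refl
∈-last (x ∷ y ∷ ys) eq   = there (∈-last (y ∷ ys) eq)

+-lex-< : ∀ N {d₁ d₂ i} j → d₁ < d₂ → i < N → d₁ * N + i < d₂ * N + j
+-lex-< N {d₁} {d₂} {i} j d₁<d₂ i<N = begin-strict
  d₁ * N + i    <⟨ +-monoʳ-< (d₁ * N) i<N ⟩
  d₁ * N + N    ≡⟨ +-comm (d₁ * N) N ⟩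
  suc d₁ * N    ≤⟨ *-monoˡ-≤ N d₁<d₂ ⟩
  d₂ * N        ≤⟨ m≤m+n (d₂ * N) j ⟩
  d₂ * N + j    ∎
  where open ≤-Reasoning

within-window : ∀ {d r m n} → d ≤ r → m ≤ n + d → n ≤ m + d → n ∸ r ≤ m × m < n ∸ r + (2 * r + 1)
within-window {r = r} {m} {n} d≤r m≤n+d n≤m+d =
  (begin
    n ∸ r      ≤⟨ ∸-monoˡ-≤ r (≤-trans n≤m+d (+-monoʳ-≤ m d≤r)) ⟩
    m + r ∸ r  ≡⟨ m+n∸n≡m m r ⟩
    m          ∎) ,
  (begin-strict
    m                        ≤⟨ ≤-trans m≤n+d (+-monoʳ-≤ n d≤r) ⟩
    n + r                    ≤⟨ +-monoˡ-≤ r (m≤n+m∸n n r) ⟩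
    r + (n ∸ r) + r          <⟨ n<1+n _ ⟩
    suc (r + (n ∸ r) + r)    ≡⟨ regroup r (n ∸ r) ⟩
    n ∸ r + (2 * r + 1)      ∎)
  where
    open ≤-Reasoning
    regroup : ∀ r b → suc (r + b + r) ≡ b + (2 * r + 1)
    regroup = solve-∀

module _ {A : Set} where

  AtMost-weaken : ∀ {k} {P Q : A → Set} → (∀ x → P x → Q x) → AtMost k Q → AtMost k P
  AtMost-weaken P⇒Q (xs , len , Q⊆xs) = xs , len , λ x px → Q⊆xs x (P⇒Q x px)

  AtMost-⊎ : ∀ {m n} {P Q : A → Set} → AtMost m P → AtMost n Q → AtMost (m + n) (λ x → P x ⊎ Q x)
  AtMost-⊎ {P = P} {Q} (xs , xs≤m , P⊆xs) (ys , ys≤n , Q⊆ys) =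
    xs ++ ys , ≤-trans (≤-reflexive (length-++ xs)) (+-mono-≤ xs≤m ys≤n) , P⊎Q⊆xs++ys
    where
      P⊎Q⊆xs++ys : ∀ x → P x ⊎ Q x → x ∈ xs ++ ys
      P⊎Q⊆xs++ys x (inj₁ px) = ∈-++⁺ˡ (P⊆xs x px)
      P⊎Q⊆xs++ys x (inj₂ qx) = ∈-++⁺ʳ xs (Q⊆ys x qx)

  AtMost-window : ∀ {k} {P : A → Set} (f : A → ℕ) → (∀ i → AtMost k (λ x → P x × f x ≡ i)) →
                  ∀ base c → AtMost (k * c) (λ x → P x × base ≤ f x × f x < base + c)
  AtMost-window f _ base zero = [] , z≤n , λ x (_ , b≤fx , fx<b+0) →
    ⊥-elim (<⇒≱ fx<b+0 (subst (_≤ f x) (≡-sym (+-identityʳ base)) b≤fx))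
  AtMost-window {k} {P} f narrow base (suc c) =
    AtMost-weaken split (subst (λ m → AtMost m (λ x → Layer x ⊎ Window x)) (≡-sym (*-suc k c))
      (AtMost-⊎ (narrow base) (AtMost-window f narrow (suc base) c)))
    where
      Layer Window : A → Set
      Layer x = P x × f x ≡ base
      Window x = P x × suc base ≤ f x × f x < suc base + c
      split : ∀ x → P x × base ≤ f x × f x < base + suc c → Layer x ⊎ Window x
      split x (px , b≤fx , fx<) with f x ≟ base
      ... | yes fx≡b = inj₁ (px , fx≡b)
      ... | no  fx≢b = inj₂ (px , ≤∧≢⇒< b≤fx (fx≢b ∘ ≡-sym) , subst (f x <_) (+-suc base c) fx<)

module _ {G : Graph} (layer : Vtx G → ℕ) (layering : IsLayering G layer) where

  layer-drift : ∀ {u x} ys → Linked (Edge G) (u ∷ ys) → last (u ∷ ys) ≡ just x →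
                layer x ≤ layer u + length ys × layer u ≤ layer x + length ys
  layer-drift {u} [] _ refl = m≤m+n (layer u) 0 , m≤m+n (layer u) 0
  layer-drift {u} {x} (y ∷ ys) (e ∷ l) la
    with x≤y , y≤x ← layer-drift ys l la | u≤y , y≤u ← layering u y e =
    (begin
      layer x                   ≤⟨ x≤y ⟩
      layer y + length ys       ≤⟨ +-monoˡ-≤ (length ys) y≤u ⟩
      suc (layer u + length ys) ≡⟨ +-suc (layer u) (length ys) ⟨
      layer u + suc (length ys) ∎) ,
    (begin
      layer u                   ≤⟨ u≤y ⟩
      suc (layer y)             ≤⟨ s≤s y≤x ⟩
      suc (layer x + length ys) ≡⟨ +-suc (layer x) (length ys) ⟨
      layer x + suc (length ys) ∎)
    where open ≤-Reasoning

module GraphPaths (G : Graph) where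
  open import Data.List.Membership.DecPropositional (_≟ᶠ_ {n G}) using (_∈?_)

  edge-sym : ∀ {x y} → Edge G x y → Edge G y x
  edge-sym {x} {y} e = trans (Graph.sym G y x) e

  edge-irrefl : ∀ {x} → ¬ Edge G x x
  edge-irrefl {x} e with trans (≡-sym e) (Graph.irrefl G x)
  ... | ()

  path-cons : ∀ {a y b ws} → Edge G a y → a ∉ ws → PathFromTo G y b ws → PathFromTo G a b (a ∷ ws)
  path-cons {ws = _ ∷ _} e a∉ws (l , u , refl , la) = e ∷ l , ¬Any⇒All¬ _ a∉ws ∷ u , refl , la

  path-suffix : ∀ {a b x ws} → x ∈ ws → PathFromTo G a b ws →
                ∃₂ λ A B → ws ≡ A ++ x ∷ B × PathFromTo G x b (x ∷ B)
  path-suffix {ws = w ∷ ws} (here refl) (l , u , _ , la) = [] , ws , refl , l , u , refl , la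
  path-suffix {ws = w ∷ y ∷ ys} (there x∈) (l , _ ∷ u , _ , la)
    with A , B , eq , path ← path-suffix x∈ (Linked.tail l , u , refl , la)
    = w ∷ A , B , cong (w ∷_) eq , path

  EdgeWithin : (Vtx G → Set) → Vtx G → Vtx G → Set
  EdgeWithin P x y = Edge G x y × P x × P y

  EdgeWithin-sym : ∀ {P x y} → EdgeWithin P x y → EdgeWithin P y x
  EdgeWithin-sym (e , px , py) = edge-sym e , py , px

  path⇒star : ∀ {P a b ws} → PathFromTo G a b ws → All P ws → Star (EdgeWithin P) a b
  path⇒star {ws = _ ∷ []}    (_ , _ , refl , refl) _ = ε
  path⇒star {ws = _ ∷ _ ∷ _} (e ∷ l , _ ∷ u , refl , la) (pa ∷ pws@(py ∷ _)) =
    (e , pa , py) ◅ path⇒star (l , u , refl , la) pws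

  -- Shortcutting a walk at the first repeated vertex.
  star⇒path : ∀ {P a b} → P a → Star (EdgeWithin P) a b → ∃ λ ws → PathFromTo G a b ws × All P ws
  star⇒path {a = a} pa ε = a ∷ [] , ([-] , [] ∷ [] , refl , refl) , pa ∷ []
  star⇒path {P} {a} pa ((e , _ , py) ◅ walk) with ws , path , pws ← star⇒path py walk | a ∈? ws
  ... | yes a∈ws with A , B , refl , path′ ← path-suffix a∈ws path = a ∷ B , path′ , ++⁻ʳ A pws
  ... | no  a∉ws = a ∷ ws , path-cons e a∉ws path , pa ∷ pws

  cycle-through : ∀ {s p q ws} → Edge G s p → Edge G q s → p ≢ q →
                  PathFromTo G p q ws → All (s ≢_) ws → HasCycle G
  cycle-through {ws = _ ∷ []} _ _ p≢q (_ , _ , refl , refl) _ = ⊥-elim (p≢q refl)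
  cycle-through {s} {p} {q} {p ∷ w ∷ ws} sp qs _ (l , u , refl , la) s∉ws =
    s , q , s ∷ p ∷ w ∷ ws , (sp ∷ l , s∉ws ∷ u , refl , la) , s≤s (s≤s (s≤s z≤n)) , qs

module RootedTree (T : Graph) (tree : IsTree T) where
  open GraphPaths T public
  open import Data.List.Membership.DecPropositional (_≟ᶠ_ {n T}) using (_∈?_)

  path-unique : ∀ {s r} ps qs → PathFromTo T s r ps → PathFromTo T s r qs → ps ≡ qs
  path-unique (_ ∷ []) (_ ∷ []) (_ , _ , refl , _) (_ , _ , refl , _) = refl
  path-unique (_ ∷ []) (_ ∷ q ∷ qs) (_ , _ , refl , refl) (_ , s∉qs ∷ _ , refl , la) =
    ⊥-elim (All.lookup s∉qs (∈-last (q ∷ qs) la) refl)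
  path-unique (_ ∷ p ∷ ps) (_ ∷ []) (_ , s∉ps ∷ _ , refl , la) (_ , _ , refl , refl) =
    ⊥-elim (All.lookup s∉ps (∈-last (p ∷ ps) la) refl)
  path-unique (s ∷ p ∷ ps) (_ ∷ q ∷ qs) (sp ∷ lp , s∉ps ∷ up , refl , lap)
                                        (sq ∷ lq , s∉qs ∷ uq , refl , laq) =
    cong (s ∷_) (path-unique (p ∷ ps) (q ∷ qs) (lp , up , refl , lap) (lq , uq , cong just (≡-sym p≡q) , laq))
    where
      detour : ∃ λ ws → PathFromTo T p q ws × All (s ≢_) ws
      detour = star⇒path (All.head s∉ps)
        (path⇒star (lp , up , refl , lap) s∉ps ◅◅
         reverse EdgeWithin-sym (path⇒star (lq , uq , refl , laq) s∉qs))

      p≡q : p ≡ q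
      p≡q = decidable-stable (p ≟ᶠ q) λ p≢q →
        let _ , path , s∉path = detour
        in IsTree.acyclic tree (cycle-through sp (edge-sym sq) p≢q path s∉path)

  root : Vtx T
  root = IsTree.nonempty tree

  rootPath : Vtx T → List (Vtx T)
  rootPath s = proj₁ (IsTree.connected tree s root)

  rootPath-isPath : ∀ s → PathFromTo T s root (rootPath s)
  rootPath-isPath s = proj₂ (IsTree.connected tree s root)

  rootPath-head : ∀ s → head (rootPath s) ≡ just s
  rootPath-head s = proj₁ (proj₂ (proj₂ (rootPath-isPath s)))

  rootPath-unique : ∀ {s ws} → PathFromTo T s root ws → rootPath s ≡ ws
  rootPath-unique = path-unique _ _ (rootPath-isPath _)

  depth : Vtx T → ℕ
  depth s = length (rootPath s)

  Ancestor : Vtx T → Vtx T → Set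
  Ancestor a s = a ∈ rootPath s

  rootPath-injective : ∀ {s t} → rootPath s ≡ rootPath t → s ≡ t
  rootPath-injective {s} {t} eq = just-injective (begin
    just s             ≡⟨ rootPath-head s ⟨
    head (rootPath s)  ≡⟨ cong head eq ⟩
    head (rootPath t)  ≡⟨ rootPath-head t ⟩
    just t             ∎)
    where open ≡-Reasoning

  ancestor-refl : ∀ s → Ancestor s s
  ancestor-refl s with rootPath s | rootPath-isPath s
  ... | _ ∷ _ | _ , _ , refl , _ = here refl

  rootPath-split : ∀ {a s} → Ancestor a s →
                   ∃ λ R → rootPath s ≡ R ++ rootPath a × depth s ≡ length R + depth a
  rootPath-split {a} {s} a∈ with R , _ , eq , path ← path-suffix a∈ (rootPath-isPath s) =
    R , split , trans (cong length split) (length-++ R)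
    where
      split : rootPath s ≡ R ++ rootPath a
      split = trans eq (cong (R ++_) (≡-sym (rootPath-unique path)))

  depth-ancestor : ∀ {a s} → Ancestor a s → depth a ≤ depth s
  depth-ancestor a∈ with R , _ , d≡ ← rootPath-split a∈ = subst (_ ≤_) (≡-sym d≡) (m≤n+m _ (length R))

  ancestor-at-depth : ∀ {a s} → Ancestor a s → depth s ≤ depth a → s ≡ a
  ancestor-at-depth a∈ s≤a with rootPath-split a∈
  ... | []    , eq , _  = rootPath-injective eq
  ... | _ ∷ R , _  , d≡ = ⊥-elim (m+n≮n (length R) _ (subst (_≤ _) d≡ s≤a))

  ancestor-antisym : ∀ {a s} → Ancestor a s → Ancestor s a → a ≡ s
  ancestor-antisym a∈ s∈ = ancestor-at-depth s∈ (depth-ancestor a∈)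

  rootPath-edge : ∀ {s t} → Edge T s t → rootPath t ≡ t ∷ rootPath s ⊎ rootPath s ≡ s ∷ rootPath t
  rootPath-edge {s} {t} e with t ∈? rootPath s | s ∈? rootPath t
  ... | no t∉ | _    = inj₁ (rootPath-unique (path-cons (edge-sym e) t∉ (rootPath-isPath s)))
  ... | yes _ | no s∉ = inj₂ (rootPath-unique (path-cons e s∉ (rootPath-isPath t)))
  ... | yes t∈ | yes s∈ = ⊥-elim (edge-irrefl (subst (Edge T s) (≡-sym (ancestor-antisym s∈ t∈)) e))

  edge-leaving-subtree : ∀ {a s t} → Edge T s t → Ancestor a s → ¬ Ancestor a t →
                         s ≡ a × depth t < depth a
  edge-leaving-subtree {a} {s} {t} e a∈ a∉ with rootPath-edge e
  ... | inj₁ eq = ⊥-elim (a∉ (subst (a ∈_) (≡-sym eq) (there a∈)))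
  ... | inj₂ eq with subst (a ∈_) eq a∈
  ...   | here refl = refl , subst (suc (depth t) ≤_) (cong length (≡-sym eq)) ≤-refl
  ...   | there a∈t = ⊥-elim (a∉ a∈t)

  path-leaving-subtree : ∀ {a c t ws} (Q : Vtx T → Set) →
    Linked (Edge T) ws → head ws ≡ just c → last ws ≡ just t →
    Ancestor a c → ¬ Ancestor a t → All Q ws → Q a × ∃ λ s → Q s × depth s < depth a
  path-leaving-subtree {ws = _ ∷ []} Q _ refl refl a∈ a∉ _ = ⊥-elim (a∉ a∈)
  path-leaving-subtree {a} {ws = _ ∷ y ∷ ys} Q (e ∷ l) refl la a∈ a∉ (qc ∷ qy ∷ qys)
    with a ∈? rootPath y
  ... | yes a∈y = path-leaving-subtree Q l refl la a∈y a∉ (qy ∷ qys)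
  ... | no  a∉y with refl , y<a ← edge-leaving-subtree e a∈ a∉y = qc , y , qy , y<a

module TopBags {G : Graph} (D : TreeDecomposition G) where
  open RootedTree (T D) (isTree D) public
  open import Data.List.Membership.DecPropositional (_≟ᶠ_ {n (T D)}) using (_∈?_)

  _∋_ : Vtx (T D) → Vtx G → Set
  t ∋ v = bag D t v ≡ true

  _∋?_ : ∀ t v → Dec (t ∋ v)
  t ∋? v = bag D t v ≟ᵇ true

  top : Vtx G → Vtx (T D)
  top v = argmin depth (proj₁ (vtxNonempty D v)) (filter (_∋? v) (allFin _))

  top-∋ : ∀ v → top v ∋ v
  top-∋ v = argmin-all depth {P = _∋ v} (proj₂ (vtxNonempty D v)) (all-filter (_∋? v) (allFin _))

  top-minimal : ∀ {v t} → t ∋ v → depth (top v) ≤ depth t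
  top-minimal {v} {t} t∋v =
    All.lookup (f[argmin]≤f[xs] _ _) (∈-filter⁺ (_∋? v) (∈-allFin t) t∋v)

  BagsBelow : Vtx (T D) → Vtx G → Set
  BagsBelow a u = ∀ t → t ∋ u → Ancestor a t

  -- Otherwise the bags of u, being connected, would leave the subtree of a and so
  -- reach a node shallower than top u.
  bags-below : ∀ {a c u} → Ancestor a c → c ∋ u → depth a ≤ depth (top u) → BagsBelow a u
  bags-below {a} {c} {u} a∈c c∋u a≤u t t∋u with a ∈? rootPath t
  ... | yes a∈t = a∈t
  ... | no  a∉t with ws , (l , _ , hd , la) , ∋u ← vtxConnected D u c t c∋u t∋u
              with _ , s , s∋u , s<a ← path-leaving-subtree (_∋ u) l hd la a∈c a∉t ∋u =
    ⊥-elim (<⇒≱ s<a (≤-trans a≤u (top-minimal s∋u)))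

  ancestor-∋ : ∀ {a c x} → Ancestor a c → c ∋ x → depth (top x) ≤ depth a → a ∋ x
  ancestor-∋ {a} {c} {x} a∈c c∋x x≤a with a ∈? rootPath (top x)
  ... | yes a∈top = subst (_∋ x) (ancestor-at-depth a∈top x≤a) (top-∋ x)
  ... | no  a∉top with ws , (l , _ , hd , la) , ∋x ← vtxConnected D x c (top x) c∋x (top-∋ x) =
    proj₁ (path-leaving-subtree (_∋ x) l hd la a∈c a∉top ∋x)

  path-end-∋ : ∀ {a u x} ys → BagsBelow a u → Linked (Edge G) (u ∷ ys) → last (u ∷ ys) ≡ just x →
               All (λ w → depth a ≤ depth (top w)) (dropLast ys) → depth (top x) ≤ depth a → a ∋ x
  path-end-∋ {x = x} [] below _ refl _ x≤a = ancestor-∋ (below (top x) (top-∋ x)) (top-∋ x) x≤a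
  path-end-∋ {u = u} (y ∷ []) below (e ∷ _) refl _ y≤a
    with c , c∋u , c∋y ← edgeCov D u y e = ancestor-∋ (below c c∋u) c∋y y≤a
  path-end-∋ {u = u} (y ∷ z ∷ zs) below (e ∷ l) la (a≤y ∷ a≤zs) x≤a
    with c , c∋u , c∋y ← edgeCov D u y e =
    path-end-∋ (z ∷ zs) (bags-below (below c c∋u) c∋y a≤y) l la a≤zs x≤a

  topRank : Vtx G → ℕ
  topRank v = depth (top v) * n G + toℕ v

  topRank-< : ∀ {x v} → depth (top x) < depth (top v) → topRank x < topRank v
  topRank-< {x} {v} x<v = +-lex-< (n G) (toℕ v) x<v (toℕ<n x)

  topRank≤⇒depth≤ : ∀ {x v} → topRank x ≤ topRank v → depth (top x) ≤ depth (top v)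
  topRank≤⇒depth≤ x≤v = ≮⇒≥ λ v<x → <⇒≱ (topRank-< v<x) x≤v

  topRank-injective : Injective _≡_ _≡_ topRank
  topRank-injective {x} {y} eq = toℕ-injective (+-cancelˡ-≡ (depth (top y) * n G) _ _ (begin
    depth (top y) * n G + toℕ x  ≡⟨ cong (λ d → d * n G + toℕ x) depth≡ ⟨
    topRank x                    ≡⟨ eq ⟩
    topRank y                    ∎))
    where
      open ≡-Reasoning
      depth≡ : depth (top x) ≡ depth (top y)
      depth≡ = ≤-antisym (topRank≤⇒depth≤ (≤-reflexive eq))
                         (topRank≤⇒depth≤ (≤-reflexive (≡-sym eq)))

  ordering : LinearOrdering G
  ordering = record { rank = topRank ; inj = topRank-injective }

  strongly-reachable-∋ : ∀ {r v x} → InS G ordering r v x → top v ∋ x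
  strongly-reachable-∋ {v = v} (_ ∷ ys , (l , _ , refl , la) , _ , x≤v , v<ys) =
    path-end-∋ ys (bags-below (ancestor-refl (top v)) (top-∋ v) ≤-refl) l la
      (All.map (λ v<w → topRank≤⇒depth≤ (<⇒≤ v<w)) v<ys) (topRank≤⇒depth≤ x≤v)

lemma30 : (G : Graph) (k r : ℕ) → 1 ≤ r → IsLayeredTreewidth G k →
    ScolAtMost G r (k * (2 * r + 1))
lemma30 G k r _ ((D , layer , layering , narrow) , _) = ordering , λ v →
  AtMost-weaken (in-window v) (AtMost-window layer (narrow (top v)) (layer v ∸ r) (2 * r + 1))
  where
    open TopBags D
    in-window : ∀ v x → InS G ordering r v x →
                top v ∋ x × layer v ∸ r ≤ layer x × layer x < layer v ∸ r + (2 * r + 1)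
    in-window v x S@(_ ∷ ys , (l , _ , refl , la) , len , _) =
      strongly-reachable-∋ S , uncurry (within-window (s≤s⁻¹ len)) (layer-drift {G} layer layering ys l la)
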